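{- Let $n\ge1$ and let $w$ be a uniformly random binary word of length $n$. Then \[ \mathbb{E}[\mathrm{des}(\mathrm{runsort}(w))]=\frac{n-5}{4}+\frac{n+1}{2^n}. \]
   Context: For a word $w=w(1)\dotsm w(n)$ over $\{0,1\}$, $k\in[n-1]$ is a descent if $w(k)>w(k+1)$ and $\mathrm{des}(w)$ is the number of descents. The runs of $w$ are its maximal weakly increasing contiguous subwords, and $\mathrm{runsort}(w)$ is the word obtained by rearranging the runs of $w$ in lexicographic order. -}

module Defs where

open import Data.Bool using (Bool; true; false; if_then_else_)
open import Data.Nat using (ℕ; zero; suc; _+_; _^_)
open import Data.Nat.Properties using (m^n≢0)
open import Data.List using (List; []; _∷_; map; concat; _++_)
open import Data.Nat.ListAction using (sum)
open import Data.Product using (_×_; _,_)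
open import Data.Integer using (+_)
open import Data.Rational using (ℚ; _/_)

-- Binary words: letters are Bool with false = 0, true = 1.

leqB : Bool → Bool → Bool
leqB true false = false
leqB _    _     = true

des : List Bool → ℕ
des []            = 0
des (x ∷ [])      = 0
des (true ∷ false ∷ w) = suc (des (false ∷ w))
des (x ∷ y ∷ w)   = des (y ∷ w)

runsAux : Bool → List Bool → List Bool × List (List Bool)
runsAux x [] = (x ∷ [] , [])
runsAux x (y ∷ ys) with runsAux y ys
... | (r , rs) = if leqB x y then (x ∷ r , rs) else (x ∷ [] , r ∷ rs)

-- the runs of a word: its maximal weakly increasing contiguous subwords, in order
runs : List Bool → List (List Bool)
runs [] = []
runs (x ∷ xs) with runsAux x xs
... | (r , rs) = r ∷ rs

-- lexicographic order on words (a proper prefix is smaller)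
lexLeq : List Bool → List Bool → Bool
lexLeq [] _ = true
lexLeq (x ∷ xs) [] = false
lexLeq (false ∷ xs) (true ∷ ys) = true
lexLeq (true ∷ xs) (false ∷ ys) = false
lexLeq (false ∷ xs) (false ∷ ys) = lexLeq xs ys
lexLeq (true ∷ xs) (true ∷ ys) = lexLeq xs ys

insert : List Bool → List (List Bool) → List (List Bool)
insert r [] = r ∷ []
insert r (s ∷ ss) = if lexLeq r s then r ∷ s ∷ ss else s ∷ insert r ss

sortRuns : List (List Bool) → List (List Bool)
sortRuns [] = []
sortRuns (r ∷ rs) = insert r (sortRuns rs)

runsort : List Bool → List Bool
runsort w = concat (sortRuns (runs w))

words : ℕ → List (List Bool)
words zero = [] ∷ []
words (suc n) = map (false ∷_) (words n) ++ map (true ∷_) (words n)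

expectation : ℕ → (List Bool → ℕ) → ℚ
expectation n f = (+ sum (map f (words n))) / (2 ^ n)
  where instance _ = m^n≢0 2 n

-- Each run of a binary word has the form 0ᵃ1ᵇ, and it contains an ascent 01
-- exactly when it is mixed (a, b ≥ 1); so the mixed runs of w are counted by
-- asc w.  After sorting, runs starting with 1 come last, and a mixed run is
-- never followed by a run of zeros, which is lexicographically smaller.  Hence
-- the descents of runsort w are exactly the boundaries between consecutive
-- mixed runs: des (runsort w) = asc w ∸ 1.  Summing over all words, asc has
-- total (n - 1) 2ⁿ⁻², and asc w = 0 for exactly the n + 1 words 1ᵃ0ᵇ.
module Submission where

open import Defs
open import Data.Bool using (Bool; true; false; if_then_else_)
open import Data.Nat using (ℕ; zero; suc; _≤_; _+_; _*_; _∸_; _^_; NonZero)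
open import Data.Nat.Properties using (m^n≢0; 0∸n≡0; +-comm; +-identityʳ; *-identityʳ; *-zeroʳ)
import Data.Nat.Solver as ℕ-Solver
open import Data.Nat.ListAction using (sum)
open import Data.Nat.ListAction.Properties using (sum-++; sum-↭)
open import Data.Integer using (+_; _-_) renaming (_+_ to _+ℤ_; _*_ to _*ℤ_)
open import Data.Integer.Properties using (pos-+; pos-*)
import Data.Integer.Solver as ℤ-Solver
open import Data.Rational using (ℚ; _/_; toℚᵘ; fromℚᵘ) renaming (_+_ to _+ℚ_)
open import Data.Rational.Properties using (toℚᵘ-injective; toℚᵘ-fromℚᵘ; toℚᵘ-homo-+; fromℚᵘ-cong)
open import Data.Rational.Unnormalised using (mkℚᵘ; *≡*) renaming (_+_ to _+ᵘ_)
open import Data.Rational.Unnormalised.Properties using (module ≃-Reasoning) renaming (+-cong to +ᵘ-cong)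
open import Data.List using (List; []; _∷_; map; concat; _++_)
open import Data.List.Properties using (map-++; map-cong; map-∘)
open import Data.List.Relation.Unary.All using (All; []; _∷_)
open import Data.List.Relation.Unary.Linked as Linked using (Linked; []; [-]; _∷_)
open import Data.List.Relation.Binary.Permutation.Propositional
  using (_↭_; ↭-refl; ↭-prep; ↭-swap; ↭-trans; ↭-sym)
open import Data.List.Relation.Binary.Permutation.Propositional.Properties
  using (All-resp-↭; map⁺)
open import Data.Product using (_×_; _,_; ∃)
open import Function using (_∘_; const)
open import Relation.Binary.PropositionalEquality

Increasing : List Bool → Set
Increasing = Linked (λ x y → leqB x y ≡ true)

LexSorted : List (List Bool) → Set
LexSorted = Linked (λ r s → lexLeq r s ≡ true)

hasOne : List Bool → Bool
hasOne []           = false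
hasOne (true ∷ _)   = true
hasOne (false ∷ xs) = hasOne xs

startsWith0 : List Bool → ℕ
startsWith0 (false ∷ _) = 1
startsWith0 _           = 0

startsWith1 : List Bool → ℕ
startsWith1 (true ∷ _) = 1
startsWith1 _          = 0

ascents : List Bool → ℕ
ascents []                 = 0
ascents (false ∷ true ∷ w) = suc (ascents (true ∷ w))
ascents (_ ∷ w)            = ascents w

ascents-false : ∀ w → ascents (false ∷ w) ≡ startsWith1 w + ascents w
ascents-false []          = refl
ascents-false (true ∷ w)  = refl
ascents-false (false ∷ w) = refl

mixed : List Bool → ℕ
mixed (false ∷ r) = if hasOne r then 1 else 0
mixed _           = 0

-- For an increasing r, this is the number of descents at the boundary of r ++ t.
boundaryDescent : List Bool → List Bool → ℕ
boundaryDescent r t = if hasOne r then startsWith0 t else 0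

mixedCount : List (List Bool) → ℕ
mixedCount rs = sum (map mixed rs)

des-++ : ∀ {r} → Increasing r → ∀ t →
         des (r ++ t) ≡ boundaryDescent r t + des t
des-++ []             t           = refl
des-++ ([-] {false})  []          = refl
des-++ ([-] {false})  (_ ∷ _)     = refl
des-++ ([-] {true})   []          = refl
des-++ ([-] {true})   (false ∷ _) = refl
des-++ ([-] {true})   (true ∷ _)  = refl
des-++ (_∷_ {false} {false} _ r↑) t = des-++ r↑ t
des-++ (_∷_ {false} {true}  _ r↑) t = des-++ r↑ t
des-++ (_∷_ {true}  {true}  _ r↑) t = des-++ r↑ t
des-++ (_∷_ {true}  {false} () _) t

RunsAuxSpec : Bool → List Bool → List Bool × List (List Bool) → Set
RunsAuxSpec x w (r , rs) =
  (∃ λ t → r ≡ x ∷ t) × All Increasing (r ∷ rs) × mixedCount (r ∷ rs) ≡ ascents (x ∷ w)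

runsAux-spec : ∀ x w → RunsAuxSpec x w (runsAux x w)
runsAux-spec false [] = (_ , refl) , [-] ∷ [] , refl
runsAux-spec true  [] = (_ , refl) , [-] ∷ [] , refl
runsAux-spec false (false ∷ ys) with runsAux false ys | runsAux-spec false ys
... | _ , _ | (_ , refl) , r↑ ∷ rs↑ , count = (_ , refl) , (refl ∷ r↑) ∷ rs↑ , count
runsAux-spec false (true ∷ ys) with runsAux true ys | runsAux-spec true ys
... | _ , _ | (_ , refl) , r↑ ∷ rs↑ , count = (_ , refl) , (refl ∷ r↑) ∷ rs↑ , cong suc count
runsAux-spec true (true ∷ ys) with runsAux true ys | runsAux-spec true ys
... | _ , _ | (_ , refl) , r↑ ∷ rs↑ , count = (_ , refl) , (refl ∷ r↑) ∷ rs↑ , count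
runsAux-spec true (false ∷ ys) with runsAux false ys | runsAux-spec false ys
... | _ , _ | (_ , refl) , rs↑ , count = (_ , refl) , [-] ∷ rs↑ , count

runs-increasing : ∀ w → All Increasing (runs w)
runs-increasing []       = []
runs-increasing (x ∷ xs) with runsAux x xs | runsAux-spec x xs
... | _ | _ , rs↑ , _ = rs↑

mixedCount-runs : ∀ w → mixedCount (runs w) ≡ ascents w
mixedCount-runs []       = refl
mixedCount-runs (x ∷ xs) with runsAux x xs | runsAux-spec x xs
... | _ | _ , _ , count = count

lexLeq-total : ∀ r s → lexLeq r s ≡ false → lexLeq s r ≡ true
lexLeq-total []          _           ()
lexLeq-total (_ ∷ _)     []          _  = refl
lexLeq-total (false ∷ r) (true ∷ s)  ()
lexLeq-total (true ∷ r)  (false ∷ s) _  = refl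
lexLeq-total (false ∷ r) (false ∷ s) r>s = lexLeq-total r s r>s
lexLeq-total (true ∷ r)  (true ∷ s)  r>s = lexLeq-total r s r>s

lexLeq-hasOne : ∀ r s → hasOne r ≡ true → hasOne s ≡ false → lexLeq r s ≡ false
lexLeq-hasOne (_ ∷ _)     []          _ _  = refl
lexLeq-hasOne (true ∷ _)  (false ∷ _) _ _  = refl
lexLeq-hasOne (false ∷ r) (false ∷ s) r₁ s₀ = lexLeq-hasOne r s r₁ s₀
lexLeq-hasOne (_ ∷ _)     (true ∷ _)  _ ()

insert-↭ : ∀ r rs → insert r rs ↭ r ∷ rs
insert-↭ r []       = ↭-refl
insert-↭ r (s ∷ ss) with lexLeq r s
... | true  = ↭-refl
... | false = ↭-trans (↭-prep s (insert-↭ r ss)) (↭-swap s r ↭-refl)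

sortRuns-↭ : ∀ rs → sortRuns rs ↭ rs
sortRuns-↭ []       = ↭-refl
sortRuns-↭ (r ∷ rs) = ↭-trans (insert-↭ r (sortRuns rs)) (↭-prep r (sortRuns-↭ rs))

insert-sorted-after : ∀ r s ss → lexLeq s r ≡ true → LexSorted (s ∷ ss) →
                      LexSorted (s ∷ insert r ss)
insert-sorted-after r s []       s≤r _ = s≤r ∷ [-]
insert-sorted-after r s (t ∷ ts) s≤r (s≤t ∷ sorted) with lexLeq r t in r≤t
... | true  = s≤r ∷ r≤t ∷ sorted
... | false = s≤t ∷ insert-sorted-after r t ts (lexLeq-total r t r≤t) sorted

insert-sorted : ∀ r rs → LexSorted rs → LexSorted (insert r rs)
insert-sorted r []       _      = [-]
insert-sorted r (s ∷ ss) sorted with lexLeq r s in r≤s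
... | true  = r≤s ∷ sorted
... | false = insert-sorted-after r s ss (lexLeq-total r s r≤s) sorted

sortRuns-sorted : ∀ rs → LexSorted (sortRuns rs)
sortRuns-sorted []       = []
sortRuns-sorted (r ∷ rs) = insert-sorted r (sortRuns rs) (sortRuns-sorted rs)

mixedCount-sortRuns : ∀ rs → mixedCount (sortRuns rs) ≡ mixedCount rs
mixedCount-sortRuns rs = sum-↭ (map⁺ mixed (sortRuns-↭ rs))

mixedCount-after-one : ∀ u ss → LexSorted ((true ∷ u) ∷ ss) → mixedCount ss ≡ 0
mixedCount-after-one u []                _            = refl
mixedCount-after-one u ((true ∷ v) ∷ ss) (_ ∷ sorted) = mixedCount-after-one v ss sorted
mixedCount-after-one u ((false ∷ _) ∷ _) (() ∷ _)
mixedCount-after-one u ([] ∷ _)          (() ∷ _)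

boundaryDescent-sorted : ∀ r ss → LexSorted (r ∷ ss) →
  boundaryDescent r (concat ss) + (mixedCount ss ∸ 1)
    ≡ mixed r + mixedCount ss ∸ 1
boundaryDescent-sorted []          _                 _       = refl
boundaryDescent-sorted (true ∷ _)  []                _       = refl
boundaryDescent-sorted (true ∷ _)  ((true ∷ _) ∷ _)  _       = refl
boundaryDescent-sorted (true ∷ _)  ((false ∷ _) ∷ _) (() ∷ _)
boundaryDescent-sorted (true ∷ _)  ([] ∷ _)          (() ∷ _)
boundaryDescent-sorted (false ∷ t) ss _ with hasOne t in t₁
boundaryDescent-sorted (false ∷ t) ss _ | false = refl
boundaryDescent-sorted (false ∷ t) [] _ | true  = refl
boundaryDescent-sorted (false ∷ t) ((true ∷ u) ∷ ss) (_ ∷ sorted) | true =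
  trans (cong (_∸ 1) none) (sym none)
  where none = mixedCount-after-one u ss sorted
boundaryDescent-sorted (false ∷ t) ((false ∷ u) ∷ ss) (r≤s ∷ _) | true with hasOne u in u₁
... | true  = refl
... | false with () ← trans (sym (lexLeq-hasOne t u t₁ u₁)) r≤s

des-concat-sorted : ∀ rs → All Increasing rs → LexSorted rs →
                    des (concat rs) ≡ mixedCount rs ∸ 1
des-concat-sorted []       _         _      = refl
des-concat-sorted (r ∷ ss) (r↑ ∷ ss↑) sorted = begin
  des (r ++ concat ss)
    ≡⟨ des-++ r↑ (concat ss) ⟩
  boundaryDescent r (concat ss) + des (concat ss)
    ≡⟨ cong (_+_ (boundaryDescent r (concat ss))) (des-concat-sorted ss ss↑ (Linked.tail sorted)) ⟩
  boundaryDescent r (concat ss) + (mixedCount ss ∸ 1)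
    ≡⟨ boundaryDescent-sorted r ss sorted ⟩
  mixed r + mixedCount ss ∸ 1 ∎
  where open ≡-Reasoning

des-runsort : ∀ w → des (runsort w) ≡ ascents w ∸ 1
des-runsort w = begin
  des (concat (sortRuns (runs w)))
    ≡⟨ des-concat-sorted (sortRuns (runs w))
         (All-resp-↭ (↭-sym (sortRuns-↭ (runs w))) (runs-increasing w))
         (sortRuns-sorted (runs w)) ⟩
  mixedCount (sortRuns (runs w)) ∸ 1
    ≡⟨ cong (_∸ 1) (trans (mixedCount-sortRuns (runs w)) (mixedCount-runs w)) ⟩
  ascents w ∸ 1 ∎
  where open ≡-Reasoning

sum-map-+ : ∀ {A : Set} (f g : A → ℕ) xs →
            sum (map (λ x → f x + g x) xs) ≡ sum (map f xs) + sum (map g xs)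
sum-map-+ f g []       = refl
sum-map-+ f g (x ∷ xs) = trans (cong (_+_ (f x + g x)) (sum-map-+ f g xs))
  (solve 4 (λ a b c d → a :+ b :+ (c :+ d) := a :+ c :+ (b :+ d)) refl
     (f x) (g x) (sum (map f xs)) (sum (map g xs)))
  where open ℕ-Solver.+-*-Solver

sumWords : ℕ → (List Bool → ℕ) → ℕ
sumWords n f = sum (map f (words n))

sumWords-suc : ∀ n f →
  sumWords (suc n) f ≡ sumWords n (f ∘ (false ∷_)) + sumWords n (f ∘ (true ∷_))
sumWords-suc n f = begin
  sum (map f (map (false ∷_) (words n) ++ map (true ∷_) (words n)))
    ≡⟨ cong sum (map-++ f (map (false ∷_) (words n)) _) ⟩
  sum (map f (map (false ∷_) (words n)) ++ map f (map (true ∷_) (words n)))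
    ≡⟨ sum-++ (map f (map (false ∷_) (words n))) _ ⟩
  sum (map f (map (false ∷_) (words n))) + sum (map f (map (true ∷_) (words n)))
    ≡⟨ cong₂ (λ a b → sum a + sum b) (sym (map-∘ (words n))) (sym (map-∘ (words n))) ⟩
  sumWords n (f ∘ (false ∷_)) + sumWords n (f ∘ (true ∷_)) ∎
  where open ≡-Reasoning

sumWords-cong : ∀ n {f g} → (∀ w → f w ≡ g w) → sumWords n f ≡ sumWords n g
sumWords-cong n f≗g = cong sum (map-cong f≗g (words n))

sumWords-+ : ∀ n f g → sumWords n (λ w → f w + g w) ≡ sumWords n f + sumWords n g
sumWords-+ n f g = sum-map-+ f g (words n)

sumWords-const : ∀ n c → sumWords n (const c) ≡ 2 ^ n * c
sumWords-const zero    c = refl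
sumWords-const (suc n) c = begin
  sumWords (suc n) (const c)                ≡⟨ sumWords-suc n (const c) ⟩
  sumWords n (const c) + sumWords n (const c) ≡⟨ cong₂ _+_ (sumWords-const n c) (sumWords-const n c) ⟩
  2 ^ n * c + 2 ^ n * c                      ≡⟨ solve 2 (λ p c → p :* c :+ p :* c := con 2 :* p :* c) refl (2 ^ n) c ⟩
  2 ^ suc n * c                              ∎
  where open ≡-Reasoning; open ℕ-Solver.+-*-Solver

sumWords-startsWith1 : ∀ n → sumWords (suc n) startsWith1 ≡ 2 ^ n
sumWords-startsWith1 n = begin
  sumWords (suc n) startsWith1              ≡⟨ sumWords-suc n startsWith1 ⟩
  sumWords n (const 0) + sumWords n (const 1) ≡⟨ cong₂ _+_ (sumWords-const n 0) (sumWords-const n 1) ⟩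
  2 ^ n * 0 + 2 ^ n * 1                      ≡⟨ solve 1 (λ p → p :* con 0 :+ p :* con 1 := p) refl (2 ^ n) ⟩
  2 ^ n                                      ∎
  where open ≡-Reasoning; open ℕ-Solver.+-*-Solver

sumWords-ascents-suc : ∀ n →
  sumWords (suc n) ascents ≡ sumWords n startsWith1 + sumWords n ascents + sumWords n ascents
sumWords-ascents-suc n = begin
  sumWords (suc n) ascents
    ≡⟨ sumWords-suc n ascents ⟩
  sumWords n (ascents ∘ (false ∷_)) + sumWords n ascents
    ≡⟨ cong (_+ sumWords n ascents) (sumWords-cong n ascents-false) ⟩
  sumWords n (λ w → startsWith1 w + ascents w) + sumWords n ascents
    ≡⟨ cong (_+ sumWords n ascents) (sumWords-+ n startsWith1 ascents) ⟩
  sumWords n startsWith1 + sumWords n ascents + sumWords n ascents ∎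
  where open ≡-Reasoning

sumWords-ascents : ∀ n → 4 * sumWords (suc n) ascents + 2 ^ suc n ≡ suc n * 2 ^ suc n
sumWords-ascents zero    = refl
sumWords-ascents (suc n) = begin
  4 * sumWords (suc (suc n)) ascents + 2 ^ suc (suc n)
    ≡⟨ cong (λ a → 4 * a + 2 ^ suc (suc n))
            (trans (sumWords-ascents-suc (suc n)) (cong (λ s → s + A + A) (sumWords-startsWith1 n))) ⟩
  4 * (2 ^ n + A + A) + 2 ^ suc (suc n)
    ≡⟨ solve 2 (λ p a → con 4 :* (p :+ a :+ a) :+ con 2 :* (con 2 :* p)
                      := con 2 :* (con 4 :* a :+ con 2 :* p) :+ con 2 :* (con 2 :* p)) refl (2 ^ n) A ⟩
  2 * (4 * A + 2 ^ suc n) + 2 ^ suc (suc n)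
    ≡⟨ cong (λ a → 2 * a + 2 ^ suc (suc n)) (sumWords-ascents n) ⟩
  2 * (suc n * 2 ^ suc n) + 2 ^ suc (suc n)
    ≡⟨ solve 2 (λ p n → con 2 :* ((con 1 :+ n) :* (con 2 :* p)) :+ con 2 :* (con 2 :* p)
                      := (con 2 :+ n) :* (con 2 :* (con 2 :* p))) refl (2 ^ n) n ⟩
  suc (suc n) * 2 ^ suc (suc n) ∎
  where
  open ≡-Reasoning
  open ℕ-Solver.+-*-Solver
  A = sumWords (suc n) ascents

-- The ascent-free words are the n + 1 words 1ᵃ0ᵇ; the only one starting with 0 is 0ⁿ.
sumWords-ascentFree-false : ∀ n → sumWords n (λ w → 1 ∸ ascents (false ∷ w)) ≡ 1
sumWords-ascentFree-false zero    = refl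
sumWords-ascentFree-false (suc n) = begin
  sumWords (suc n) (λ w → 1 ∸ ascents (false ∷ w))
    ≡⟨ sumWords-suc n _ ⟩
  sumWords n (λ w → 1 ∸ ascents (false ∷ w)) + sumWords n (λ w → 1 ∸ suc (ascents (true ∷ w)))
    ≡⟨ cong₂ _+_ (sumWords-ascentFree-false n)
                 (trans (sumWords-cong n (λ w → 0∸n≡0 (ascents w))) (sumWords-const n 0)) ⟩
  1 + 2 ^ n * 0
    ≡⟨ cong suc (*-zeroʳ (2 ^ n)) ⟩
  1 ∎
  where open ≡-Reasoning

sumWords-ascentFree : ∀ n → sumWords n (λ w → 1 ∸ ascents w) ≡ suc n
sumWords-ascentFree zero    = refl
sumWords-ascentFree (suc n) = begin
  sumWords (suc n) (λ w → 1 ∸ ascents w)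
    ≡⟨ sumWords-suc n _ ⟩
  sumWords n (λ w → 1 ∸ ascents (false ∷ w)) + sumWords n (λ w → 1 ∸ ascents w)
    ≡⟨ cong₂ _+_ (sumWords-ascentFree-false n) (sumWords-ascentFree n) ⟩
  suc (suc n) ∎
  where open ≡-Reasoning

∸1+1≡+1∸ : ∀ k → k ∸ 1 + 1 ≡ k + (1 ∸ k)
∸1+1≡+1∸ zero    = refl
∸1+1≡+1∸ (suc k) =
  trans (+-comm k 1) (sym (trans (cong (_+_ (suc k)) (0∸n≡0 k)) (+-identityʳ (suc k))))

sumWords-ascents∸1 : ∀ n →
  sumWords n (λ w → ascents w ∸ 1) + 2 ^ n ≡ sumWords n ascents + suc n
sumWords-ascents∸1 n = begin
  sumWords n (λ w → ascents w ∸ 1) + 2 ^ n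
    ≡⟨ cong (_+_ (sumWords n (λ w → ascents w ∸ 1)))
            (sym (trans (sumWords-const n 1) (*-identityʳ (2 ^ n)))) ⟩
  sumWords n (λ w → ascents w ∸ 1) + sumWords n (const 1)
    ≡⟨ sumWords-+ n (λ w → ascents w ∸ 1) (const 1) ⟨
  sumWords n (λ w → ascents w ∸ 1 + 1)
    ≡⟨ sumWords-cong n (λ w → ∸1+1≡+1∸ (ascents w)) ⟩
  sumWords n (λ w → ascents w + (1 ∸ ascents w))
    ≡⟨ sumWords-+ n ascents (λ w → 1 ∸ ascents w) ⟩
  sumWords n ascents + sumWords n (λ w → 1 ∸ ascents w)
    ≡⟨ cong (_+_ (sumWords n ascents)) (sumWords-ascentFree n) ⟩
  sumWords n ascents + suc n ∎
  where open ≡-Reasoning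

sumWords-des-runsort : ∀ m → let n = suc m in
  4 * sumWords n (λ w → des (runsort w)) + 5 * 2 ^ n ≡ n * 2 ^ n + 4 * (n + 1)
sumWords-des-runsort m = begin
  4 * sumWords (suc m) (λ w → des (runsort w)) + 5 * p
    ≡⟨ cong (λ d → 4 * d + 5 * p) (sumWords-cong (suc m) des-runsort) ⟩
  4 * D + 5 * p
    ≡⟨ solve 2 (λ d p → con 4 :* d :+ con 5 :* p := con 4 :* (d :+ p) :+ p) refl D p ⟩
  4 * (D + p) + p
    ≡⟨ cong (λ z → 4 * z + p) (sumWords-ascents∸1 (suc m)) ⟩
  4 * (A + suc (suc m)) + p
    ≡⟨ solve 3 (λ a m p → con 4 :* (a :+ (con 2 :+ m)) :+ p
                        := con 4 :* a :+ p :+ con 4 :* ((con 1 :+ m) :+ con 1)) refl A m p ⟩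
  4 * A + p + 4 * (suc m + 1)
    ≡⟨ cong (_+ 4 * (suc m + 1)) (sumWords-ascents m) ⟩
  suc m * p + 4 * (suc m + 1) ∎
  where
  open ≡-Reasoning
  open ℕ-Solver.+-*-Solver
  p = 2 ^ suc m
  D = sumWords (suc m) (λ w → ascents w ∸ 1)
  A = sumWords (suc m) ascents

fromℚᵘ-homo-+ : ∀ p q → fromℚᵘ (p +ᵘ q) ≡ fromℚᵘ p +ℚ fromℚᵘ q
fromℚᵘ-homo-+ p q = toℚᵘ-injective (begin
  toℚᵘ (fromℚᵘ (p +ᵘ q))            ≈⟨ toℚᵘ-fromℚᵘ (p +ᵘ q) ⟩
  p +ᵘ q                            ≈⟨ +ᵘ-cong (toℚᵘ-fromℚᵘ p) (toℚᵘ-fromℚᵘ q) ⟨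
  toℚᵘ (fromℚᵘ p) +ᵘ toℚᵘ (fromℚᵘ q) ≈⟨ toℚᵘ-homo-+ (fromℚᵘ p) (fromℚᵘ q) ⟨
  toℚᵘ (fromℚᵘ p +ℚ fromℚᵘ q)       ∎)
  where open ≃-Reasoning

+D/P≡[n-5]/4+[n+1]/P : ∀ D n P .{{_ : NonZero P}} → 4 * D + 5 * P ≡ n * P + 4 * (n + 1) →
                       + D / P ≡ (+ n - + 5) / 4 +ℚ + (n + 1) / P
+D/P≡[n-5]/4+[n+1]/P D n (suc p) eq = begin
  fromℚᵘ (mkℚᵘ (+ D) p) ≡⟨ fromℚᵘ-cong {mkℚᵘ (+ D) p} {x +ᵘ y} (*≡* cross) ⟩
  fromℚᵘ (x +ᵘ y)       ≡⟨ fromℚᵘ-homo-+ x y ⟩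
  fromℚᵘ x +ℚ fromℚᵘ y  ∎
  where
  open ≡-Reasoning
  open ℤ-Solver.+-*-Solver
  P = suc p
  x = mkℚᵘ (+ n - + 5) 3
  y = mkℚᵘ (+ (n + 1)) p
  eqℤ : + 4 *ℤ + D +ℤ + 5 *ℤ + P ≡ + n *ℤ + P +ℤ + 4 *ℤ (+ n +ℤ + 1)
  eqℤ = begin
    + 4 *ℤ + D +ℤ + 5 *ℤ + P      ≡⟨ cong₂ _+ℤ_ (pos-* 4 D) (pos-* 5 P) ⟨
    + (4 * D) +ℤ + (5 * P)        ≡⟨ pos-+ (4 * D) (5 * P) ⟨
    + (4 * D + 5 * P)             ≡⟨ cong +_ eq ⟩
    + (n * P + 4 * (n + 1))       ≡⟨ pos-+ (n * P) (4 * (n + 1)) ⟩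
    + (n * P) +ℤ + (4 * (n + 1))
      ≡⟨ cong₂ _+ℤ_ (pos-* n P) (trans (pos-* 4 (n + 1)) (cong (+ 4 *ℤ_) (pos-+ n 1))) ⟩
    + n *ℤ + P +ℤ + 4 *ℤ (+ n +ℤ + 1) ∎
  cross : + D *ℤ + (4 * P) ≡ ((+ n - + 5) *ℤ + P +ℤ + (n + 1) *ℤ + 4) *ℤ + P
  cross = begin
    + D *ℤ + (4 * P)
      ≡⟨ cong (+ D *ℤ_) (pos-* 4 P) ⟩
    + D *ℤ (+ 4 *ℤ + P)
      ≡⟨ solve 2 (λ d q → d :* (con (+ 4) :* q)
                         := (con (+ 4) :* d :+ con (+ 5) :* q) :* q :- con (+ 5) :* q :* q)
                   refl (+ D) (+ P) ⟩
    (+ 4 *ℤ + D +ℤ + 5 *ℤ + P) *ℤ + P - + 5 *ℤ + P *ℤ + P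
      ≡⟨ cong (λ z → z *ℤ + P - + 5 *ℤ + P *ℤ + P) eqℤ ⟩
    (+ n *ℤ + P +ℤ + 4 *ℤ (+ n +ℤ + 1)) *ℤ + P - + 5 *ℤ + P *ℤ + P
      ≡⟨ solve 2 (λ m q → (m :* q :+ con (+ 4) :* (m :+ con (+ 1))) :* q :- con (+ 5) :* q :* q
                         := ((m :- con (+ 5)) :* q :+ (m :+ con (+ 1)) :* con (+ 4)) :* q)
                   refl (+ n) (+ P) ⟩
    ((+ n - + 5) *ℤ + P +ℤ (+ n +ℤ + 1) *ℤ + 4) *ℤ + P
      ≡⟨ cong (λ z → ((+ n - + 5) *ℤ + P +ℤ z *ℤ + 4) *ℤ + P) (pos-+ n 1) ⟨
    ((+ n - + 5) *ℤ + P +ℤ + (n + 1) *ℤ + 4) *ℤ + P ∎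

mainTheorem14 : (n : ℕ) → 1 ≤ n →
    expectation n (λ w → des (runsort w))
      ≡ ((+ n - + 5) / 4) +ℚ (_/_ (+ (n + 1)) (2 Data.Nat.^ n) {{m^n≢0 2 n}})
mainTheorem14 (suc m) _ =
  +D/P≡[n-5]/4+[n+1]/P (sumWords (suc m) (λ w → des (runsort w))) (suc m) (2 ^ suc m)
    {{m^n≢0 2 (suc m)}} (sumWords-des-runsort m)
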